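{- There is a constant $C$ such that the following holds. Let $(H,\mathcal{F})$ be a $(3,3)$-system with $|\mathcal{F}| \geq C$ such that every vertex of $H$ lies in at least one set of $\mathcal{F}$. Then $(H,\mathcal{F})$ is isomorphic to $(H'_{2,l},\mathcal{F}'_{2,l})$ for some even integer $l$.
   Context: All graphs are finite and simple. A $(3,3)$-system is a pair $(H,\mathcal{F})$ where $H$ is a triangle-free graph and $\mathcal{F}$ is a family (without repeated elements) of subsets of $V(H)$, each of size exactly $3$, each a maximal independent set of $H$, and any two distinct sets of $\mathcal{F}$ intersect. For an even integer $l$, $H_{2,l}$ is the graph obtained from the complete bipartite graph $K_{l/2,l/2}$ by removing a perfect matching, and $\mathcal{F}_{2,l}$ is the family of the $l/2$ pairs of vertices matched by the removed matching. $H'_{2,l}$ is obtained from $H_{2,l}$ by adding a new isolated vertex $v$, and $\mathcal{F}'_{2,l}=\{P\cup\{v\}: P\in\mathcal{F}_{2,l}\}$. -}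

module Defs where

open import Data.Nat using (ℕ)
open import Data.Empty using (⊥)
open import Data.Unit using (⊤)
open import Data.Bool using (Bool; true; false)
open import Data.Fin using (Fin)
open import Data.Fin.Subset using (Subset; _∈_; _∉_; _∩_; Nonempty; ∣_∣)
open import Data.List using (List; length)
open import Data.List.Relation.Unary.Unique.Propositional using (Unique)
import Data.List.Membership.Propositional as LM
open import Data.Maybe using (Maybe; just; nothing)
open import Data.Product using (_×_; ∃; ∃-syntax; Σ; _,_)
open import Relation.Binary.PropositionalEquality using (_≡_; _≢_)
open import Relation.Nullary using (¬_)
open import Function.Bundles using (_⤖_; _⇔_; Bijection)

record Graph (n : ℕ) : Set where
  field
    adj     : Fin n → Fin n → Bool
    sym     : ∀ x y → adj x y ≡ adj y x
    irrefl  : ∀ x → adj x x ≡ false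

open Graph public

Adjacent : ∀ {n} → Graph n → Fin n → Fin n → Set
Adjacent G x y = adj G x y ≡ true

TriangleFree : ∀ {n} → Graph n → Set
TriangleFree G = ∀ x y z → Adjacent G x y → Adjacent G y z → Adjacent G x z → ⊥
 

Independent : ∀ {n} → Graph n → Subset n → Set
Independent G S = ∀ x y → x ∈ S → y ∈ S → ¬ Adjacent G x y

MaximalIndependent : ∀ {n} → Graph n → Subset n → Set
MaximalIndependent G S =
  Independent G S × (∀ v → v ∉ S → ∃[ u ] (u ∈ S × Adjacent G u v))

record IsSystem33 {n : ℕ} (H : Graph n) (F : List (Subset n)) : Set where
  field
    triangleFree : TriangleFree H
    noRepeats    : Unique F
    size3        : ∀ S → S LM.∈ F → ∣ S ∣ ≡ 3
    maxIndep     : ∀ S → S LM.∈ F → MaximalIndependent H S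
    intersecting : ∀ S T → S LM.∈ F → T LM.∈ F → S ≢ T → Nonempty (S ∩ T)

-- The pair (H'_{2,l}, F'_{2,l}) with l = 2m.
-- Vertices: nothing = the extra isolated vertex v; just (i , b) = the vertex of
-- index i on side b of K_{m,m}; the removed perfect matching pairs
-- (i , false) with (i , true).
V′ : ℕ → Set
V′ m = Maybe (Fin m × Bool)

AdjH′ : ∀ {m} → V′ m → V′ m → Set
AdjH′ nothing _ = ⊥
AdjH′ (just _) nothing = ⊥
AdjH′ (just (i , b)) (just (j , c)) = (b ≢ c) × (i ≢ j)

-- Membership in the set P_i ∪ {v} of F'_{2,l}, for P_i = {(i,false),(i,true)}.
InF′ : ∀ {m} → Fin m → V′ m → Set
InF′ i nothing = ⊤
InF′ i (just (j , _)) = j ≡ i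

IsoToH′ : ∀ {n} → Graph n → List (Subset n) → ℕ → Set
IsoToH′ {n} H F m =
  Σ (Fin n ⤖ V′ m) λ σ →
    let f = Bijection.to σ in
      (∀ x y → Adjacent H x y ⇔ AdjH′ (f x) (f y))
    × (∀ S → S LM.∈ F → ∃[ i ] (∀ x → x ∈ S ⇔ InF′ i (f x)))
    × (∀ i → ∃[ S ] (S LM.∈ F × (∀ x → x ∈ S ⇔ InF′ i (f x))))

{-# OPTIONS --safe #-}
-- Two members of F through the same two vertices have adjacent third vertices (the third vertex
-- of one has a neighbour in the other, a maximal independent set), so by triangle-freeness at most
-- two members contain any pair. Hence a vertex missed by some member lies in at most six members,
-- and as every member meets a fixed member S₀, once |F| > 18 some vertex v lies in all of them.
-- This v is isolated, and the same counting shows that every other vertex x lies in exactly one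
-- member {v, x, x̄}. No vertex is adjacent to both x and x̄, and every vertex outside {v, x, x̄} is
-- adjacent to one of them; so for one fixed pair r, r̄ the sets {r̄} ∪ N(r) and {r} ∪ N(r̄) split
-- H − v into two independent sides, every pair {x, x̄} meets both, and vertices on opposite sides
-- in different pairs are adjacent: H is H′_{2,l} with l = 2|F|.
module Submission where

open import Defs renaming (sym to adj-sym)
open import Data.Nat using (ℕ; _≥_)
open import Data.Fin.Subset using (Subset; _∈_)
open import Data.List using (List; length)
import Data.List.Membership.Propositional as LM

open import Level using (0ℓ)
open import Function using (_∘_; id)
open import Function.Bundles using (_⇔_; mk⇔; mk⤖)
open import Function.Definitions using (Injective; Surjective)
open import Data.Empty using (⊥; ⊥-elim)
open import Data.Bool using (Bool; true; false; not)
open import Data.Bool.Properties using (¬-not; not-involutive)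
import Data.Bool.Properties as Bool
open import Data.Maybe using (just; nothing)
open import Data.Maybe.Properties using (just-injective)
open import Data.Product using (∃-syntax; _×_; _,_; proj₁; proj₂)
open import Data.Product.Properties using (,-injectiveˡ; ,-injectiveʳ)
open import Data.Sum using (_⊎_; inj₁; inj₂; [_,_]′)
open import Data.Nat using (_≤_; _<_; _+_; _*_; z≤n; s≤s; s≤s⁻¹; suc)
open import Data.Nat.Properties
  using (≤-refl; ≤-reflexive; ≤-trans; +-mono-≤; +-suc; n≤1+n; n≮0; <⇒≱; *-monoˡ-≤; m≤m+n;
         module ≤-Reasoning)
open import Data.Fin using (Fin; zero; suc; _≟_; fromℕ<)
open import Data.Vec using (_∷_)
open import Data.Vec.Properties using (≡-dec)
open import Data.Fin.Subset using (_∉_; _⊆_; _-_; ⁅_⁆; ∣_∣; inside; outside)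
open import Data.Fin.Subset.Properties
  using (_∈?_; drop-there; p─⊥≡p; p─q⊆p; x∈p∧x≢y⇒x∈p-y; x∈p⇒∣p-x∣<∣p∣; nonempty?; Empty-unique; ∣⊥∣≡0;
         ⊆-antisym; x∈p∩q⁻)
open import Data.List using ([]; _∷_; filter; lookup)
open import Data.List.Membership.Propositional using (find; lose) renaming (_∈_ to _∈ₗ_; _∉_ to _∉ₗ_)
open import Data.List.Membership.Propositional.Properties using (∈-lookup)
open import Data.List.Relation.Unary.All as All using (All; []; _∷_; all?)
open import Data.List.Relation.Unary.All.Properties using (¬All⇒Any¬; ¬Any⇒All¬; all-filter)
import Data.List.Relation.Unary.All.Properties as Allₚ
open import Data.List.Relation.Unary.Any as Any using (Any; here; there; any?)
import Data.List.Relation.Unary.Any.Properties as Anyₚ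
open import Data.List.Relation.Unary.AllPairs using ([]; _∷_)
open import Data.List.Relation.Unary.Unique.Propositional using (Unique)
import Data.List.Relation.Unary.Unique.Propositional.Properties as Unique
open import Relation.Binary.PropositionalEquality
  using (_≡_; _≢_; refl; sym; trans; cong; subst; ≢-sym; module ≡-Reasoning)
open import Relation.Nullary using (¬_; Dec; yes; no; does; contradiction; _⊎-dec_)
open import Relation.Unary using (Pred; Decidable)
open import Relation.Unary.Properties using (∁?)

x∉p-x : ∀ {n} (p : Subset n) x → x ∉ p - x
x∉p-x (s ∷ p) zero ()
x∉p-x (s ∷ p) (suc x) x∈p-x = x∉p-x p x (drop-there x∈p-x)

∣p∣≤1+∣p-x∣ : ∀ {n} (p : Subset n) x → ∣ p ∣ ≤ suc ∣ p - x ∣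
∣p∣≤1+∣p-x∣ (inside ∷ p) zero = ≤-reflexive (cong (suc ∘ ∣_∣) (sym (p─⊥≡p p)))
∣p∣≤1+∣p-x∣ (outside ∷ p) zero = ≤-trans (≤-reflexive (cong ∣_∣ (sym (p─⊥≡p p)))) (n≤1+n _)
∣p∣≤1+∣p-x∣ (inside ∷ p) (suc x) = s≤s (∣p∣≤1+∣p-x∣ p x)
∣p∣≤1+∣p-x∣ (outside ∷ p) (suc x) = ∣p∣≤1+∣p-x∣ p x

infix 4 _⊆ₗ_
_⊆ₗ_ : ∀ {n} → Subset n → List (Fin n) → Set
p ⊆ₗ xs = ∀ {x} → x ∈ p → x ∈ₗ xs

length<∣p∣⇒∃∈p∉xs : ∀ {n} (p : Subset n) xs → length xs < ∣ p ∣ → ∃[ z ] (z ∈ p × z ∉ₗ xs)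
length<∣p∣⇒∃∈p∉xs {n} p [] 0<∣p∣ with nonempty? p
... | yes (z , z∈p) = z , z∈p , λ ()
... | no ∄ = ⊥-elim (n≮0 (subst (0 <_) (trans (cong ∣_∣ (Empty-unique ∄)) (∣⊥∣≡0 n)) 0<∣p∣))
length<∣p∣⇒∃∈p∉xs p (x ∷ xs) len
  with z , z∈p-x , z∉xs ← length<∣p∣⇒∃∈p∉xs (p - x) xs (s≤s⁻¹ (≤-trans len (∣p∣≤1+∣p-x∣ p x)))
  = z , p─q⊆p p ⁅ x ⁆ z∈p-x , λ where
      (here refl) → x∉p-x p x z∈p-x
      (there z∈xs) → z∉xs z∈xs

∣p∣≤length⇒p⊆ₗxs : ∀ {n} {p : Subset n} {xs} → Unique xs → All (_∈ p) xs → ∣ p ∣ ≤ length xs → p ⊆ₗ xs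
∣p∣≤length⇒p⊆ₗxs {xs = []} [] [] ∣p∣≤0 x∈p = ⊥-elim (n≮0 (≤-trans (x∈p⇒∣p-x∣<∣p∣ x∈p) ∣p∣≤0))
∣p∣≤length⇒p⊆ₗxs {p = p} {y ∷ xs} (y∉xs ∷ u) (y∈p ∷ xs⊆p) ∣p∣≤ {x} x∈p with x ≟ y
... | yes refl = here refl
... | no x≢y = there (∣p∣≤length⇒p⊆ₗxs u xs⊆p-y ∣p-y∣≤ (x∈p∧x≢y⇒x∈p-y x∈p x≢y))
  where
  xs⊆p-y : All (_∈ p - y) xs
  xs⊆p-y = All.zipWith (λ (z∈p , y≢z) → x∈p∧x≢y⇒x∈p-y z∈p (≢-sym y≢z)) (xs⊆p , y∉xs)
  ∣p-y∣≤ : ∣ p - y ∣ ≤ length xs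
  ∣p-y∣≤ = s≤s⁻¹ (≤-trans (x∈p⇒∣p-x∣<∣p∣ y∈p) ∣p∣≤)

record Third {n} (p : Subset n) (x y : Fin n) : Set where
  field
    z     : Fin n
    z∈p   : z ∈ p
    z≢x   : z ≢ x
    z≢y   : z ≢ y
    p⊆xyz : p ⊆ₗ x ∷ y ∷ z ∷ []

third : ∀ {n} {p : Subset n} {x y} → ∣ p ∣ ≡ 3 → x ∈ p → y ∈ p → x ≢ y → Third p x y
third {p = p} {x} {y} ∣p∣≡3 x∈p y∈p x≢y
  with z , z∈p , z∉xy ← length<∣p∣⇒∃∈p∉xs p (x ∷ y ∷ []) (≤-reflexive (sym ∣p∣≡3))
  = record
    { z = z ; z∈p = z∈p ; z≢x = z≢x ; z≢y = z≢y
    ; p⊆xyz = ∣p∣≤length⇒p⊆ₗxs xyz-distinct (x∈p ∷ y∈p ∷ z∈p ∷ []) (≤-reflexive ∣p∣≡3) }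
  where
  z≢x : z ≢ x
  z≢x = z∉xy ∘ here
  z≢y : z ≢ y
  z≢y = z∉xy ∘ there ∘ here
  xyz-distinct : Unique (x ∷ y ∷ z ∷ [])
  xyz-distinct = (x≢y ∷ ≢-sym z≢x ∷ []) ∷ (≢-sym z≢y ∷ []) ∷ [] ∷ []

third∉ : ∀ {n} {p q : Subset n} {x y} → p ≢ q → x ∈ p → y ∈ p → x ∈ q → y ∈ q →
         (tp : Third p x y) (tq : Third q x y) → Third.z tq ∉ p
third∉ {p = p} {q} p≢q x∈p y∈p x∈q y∈q tp tq z′∈p with Third.p⊆xyz tp z′∈p
... | here z′≡x = Third.z≢x tq z′≡x
... | there (here z′≡y) = Third.z≢y tq z′≡y
... | there (there (here z′≡z)) = p≢q (⊆-antisym p⊆q q⊆p)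
  where
  p⊆q : p ⊆ q
  p⊆q w∈p = All.lookup (x∈q ∷ y∈q ∷ subst (_∈ q) z′≡z (Third.z∈p tq) ∷ []) (Third.p⊆xyz tp w∈p)
  q⊆p : q ⊆ p
  q⊆p w∈q = All.lookup (x∈p ∷ y∈p ∷ z′∈p ∷ []) (Third.p⊆xyz tq w∈q)

length-filter+length-filter-∁ : ∀ {A : Set} {P : Pred A 0ℓ} (P? : Decidable P) xs →
                                length (filter P? xs) + length (filter (∁? P?) xs) ≡ length xs
length-filter+length-filter-∁ P? [] = refl
length-filter+length-filter-∁ P? (x ∷ xs) with P? x
... | yes _ = cong suc (length-filter+length-filter-∁ P? xs)
... | no _ = trans (+-suc _ _) (cong suc (length-filter+length-filter-∁ P? xs))

Unique⇒lookup-injective : ∀ {A : Set} {xs : List A} → Unique xs →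
                          ∀ {i j} → lookup xs i ≡ lookup xs j → i ≡ j
Unique⇒lookup-injective {xs = _ ∷ _} _ {zero} {zero} _ = refl
Unique⇒lookup-injective (x∉xs ∷ _) {zero} {suc j} x≡xs[j] =
  ⊥-elim (All.lookup x∉xs (∈-lookup j) x≡xs[j])
Unique⇒lookup-injective (x∉xs ∷ _) {suc i} {zero} xs[i]≡x =
  ⊥-elim (All.lookup x∉xs (∈-lookup i) (sym xs[i]≡x))
Unique⇒lookup-injective (_ ∷ u) {suc i} {suc j} eq = cong suc (Unique⇒lookup-injective u eq)

AtMost : ∀ {A : Set} → ℕ → Pred A 0ℓ → Set
AtMost k P = ∀ {xs} → Unique xs → All P xs → length xs ≤ k

AtMost-⊆ : ∀ {A : Set} {k} {P Q : Pred A 0ℓ} → (∀ {a} → Q a → P a) → AtMost k P → AtMost k Q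
AtMost-⊆ Q⇒P atMost u qs = atMost u (All.map Q⇒P qs)

AtMost2-intro : ∀ {A : Set} {P : Pred A 0ℓ} →
                (∀ {a b c} → a ≢ b → a ≢ c → b ≢ c → P a → P b → P c → ⊥) → AtMost 2 P
AtMost2-intro no-three {[]} _ _ = z≤n
AtMost2-intro no-three {_ ∷ []} _ _ = s≤s z≤n
AtMost2-intro no-three {_ ∷ _ ∷ []} _ _ = s≤s (s≤s z≤n)
AtMost2-intro no-three {_ ∷ _ ∷ _ ∷ _} ((a≢b ∷ a≢c ∷ _) ∷ (b≢c ∷ _) ∷ _) (Pa ∷ Pb ∷ Pc ∷ _) =
  ⊥-elim (no-three a≢b a≢c b≢c Pa Pb Pc)

module _ {A I : Set} {M : Pred A 0ℓ} {P : I → Pred A 0ℓ} (P? : ∀ i → Decidable (P i)) where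

  Covered : List I → Pred A 0ℓ
  Covered is a = Any (λ i → P i a) is

  Covered? : ∀ is → Decidable (Covered is)
  Covered? is a = any? (λ i → P? i a) is

  length≤cover : ∀ {k} is {xs} → All (λ i → AtMost k (λ a → M a × P i a)) is →
                 Unique xs → All M xs → All (Covered is) xs → length xs ≤ length is * k
  length≤cover [] _ _ _ [] = z≤n
  length≤cover [] _ _ _ (() ∷ _)
  length≤cover {k} (i ∷ is) {xs} (atMost ∷ atMosts) u ms cs = begin
    length xs                                           ≡⟨ sym (length-filter+length-filter-∁ (P? i) xs) ⟩
    length (filter (P? i) xs) + length (filter ¬P? xs)
      ≤⟨ +-mono-≤ (atMost (Unique.filter⁺ (P? i) u) satisfying)
                  (length≤cover is atMosts (Unique.filter⁺ ¬P? u) (Allₚ.filter⁺ ¬P? ms) rest) ⟩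
    k + length is * k                                   ∎
    where
    open ≤-Reasoning
    ¬P? : Decidable (λ a → ¬ P i a)
    ¬P? = ∁? (P? i)
    satisfying : All (λ a → M a × P i a) (filter (P? i) xs)
    satisfying = All.zip (Allₚ.filter⁺ (P? i) ms , all-filter (P? i) xs)
    rest : All (Covered is) (filter ¬P? xs)
    rest = All.zipWith (λ (c , ¬Pa) → Any.tail ¬Pa c) (Allₚ.filter⁺ ¬P? cs , all-filter ¬P? xs)

  ∃-uncovered : ∀ {k} is {xs} → All (λ i → AtMost k (λ a → M a × P i a)) is →
                Unique xs → All M xs → length is * k < length xs → ∃[ a ] (a ∈ₗ xs × ¬ Covered is a)
  ∃-uncovered is {xs} atMosts u ms len with all? (Covered? is) xs
  ... | yes cs = contradiction (length≤cover is atMosts u ms cs) (<⇒≱ len)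
  ... | no ¬cs = find (¬All⇒Any¬ (Covered? is) xs ¬cs)

module System33 {n} {H : Graph n} {F : List (Subset n)} (sys : IsSystem33 H F) where
  open IsSystem33 sys

  infix 4 _~_
  _~_ : Fin n → Fin n → Set
  _~_ = Adjacent H

  ~-sym : ∀ {x y} → x ~ y → y ~ x
  ~-sym {x} {y} x~y = trans (adj-sym H y x) x~y

  ~-irrefl : ∀ {x} → ¬ x ~ x
  ~-irrefl {x} x~x with () ← trans (sym x~x) (irrefl H x)

  no-triangle : ∀ {x y z} → x ~ y → y ~ z → x ~ z → ⊥
  no-triangle = triangleFree _ _ _

  independent : ∀ {S x y} → S ∈ₗ F → x ∈ S → y ∈ S → ¬ x ~ y
  independent S∈F = proj₁ (maxIndep _ S∈F) _ _

  dominating : ∀ {S y} → S ∈ₗ F → y ∉ S → ∃[ x ] (x ∈ S × x ~ y)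
  dominating S∈F = proj₂ (maxIndep _ S∈F) _

  ∃-fresh : ∀ {S} xs → S ∈ₗ F → length xs < 3 → ∃[ z ] (z ∈ S × z ∉ₗ xs)
  ∃-fresh xs S∈F len = length<∣p∣⇒∃∈p∉xs _ xs (subst (length xs <_) (sym (size3 _ S∈F)) len)

  meet : ∀ {S T} → S ∈ₗ F → T ∈ₗ F → ∃[ w ] (w ∈ S × w ∈ T)
  meet {S} {T} S∈F T∈F with ≡-dec Bool._≟_ S T
  ... | yes refl = let w , w∈S , _ = ∃-fresh [] S∈F (s≤s z≤n) in w , w∈S , w∈S
  ... | no S≢T = let w , w∈S∩T = intersecting S T S∈F T∈F S≢T in w , x∈p∩q⁻ S T w∈S∩T

  third∈F : ∀ {S x y} → S ∈ₗ F → x ∈ S → y ∈ S → x ≢ y → Third S x y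
  third∈F S∈F = third (size3 _ S∈F)

  thirds-adjacent : ∀ {S T x y} → S ∈ₗ F → T ∈ₗ F → S ≢ T → x ∈ S → y ∈ S → x ∈ T → y ∈ T →
                    (tS : Third S x y) (tT : Third T x y) → Third.z tS ~ Third.z tT
  thirds-adjacent S∈F T∈F S≢T x∈S y∈S x∈T y∈T tS tT
    with u , u∈S , u~z′ ← dominating S∈F (third∉ S≢T x∈S y∈S x∈T y∈T tS tT)
    with Third.p⊆xyz tS u∈S
  ... | here refl = ⊥-elim (independent T∈F x∈T (Third.z∈p tT) u~z′)
  ... | there (here refl) = ⊥-elim (independent T∈F y∈T (Third.z∈p tT) u~z′)
  ... | there (there (here refl)) = u~z′

  pair≤2 : ∀ {x y} → x ≢ y → AtMost 2 (λ S → S ∈ₗ F × x ∈ S × y ∈ S)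
  pair≤2 x≢y = AtMost2-intro λ where
    S≢T S≢U T≢U (S∈F , x∈S , y∈S) (T∈F , x∈T , y∈T) (U∈F , x∈U , y∈U) →
      let tS = third∈F S∈F x∈S y∈S x≢y
          tT = third∈F T∈F x∈T y∈T x≢y
          tU = third∈F U∈F x∈U y∈U x≢y
      in no-triangle (thirds-adjacent S∈F T∈F S≢T x∈S y∈S x∈T y∈T tS tT)
                     (thirds-adjacent T∈F U∈F T≢U x∈T y∈T x∈U y∈U tT tU)
                     (thirds-adjacent S∈F U∈F S≢U x∈S y∈S x∈U y∈U tS tU)

  enumerate : ∀ {S} → S ∈ₗ F → ∃[ a ] ∃[ b ] ∃[ c ] (All (_∈ S) (a ∷ b ∷ c ∷ []) × S ⊆ₗ a ∷ b ∷ c ∷ [])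
  enumerate S∈F =
    let a , a∈S , _ = ∃-fresh [] S∈F (s≤s z≤n)
        b , b∈S , b∉a = ∃-fresh (a ∷ []) S∈F (s≤s (s≤s z≤n))
        t = third∈F S∈F a∈S b∈S (≢-sym (b∉a ∘ here))
    in a , b , Third.z t , a∈S ∷ b∈S ∷ Third.z∈p t ∷ [] , Third.p⊆xyz t

  degree≤6 : ∀ {e} → ¬ All (e ∈_) F → AtMost 6 (λ S → S ∈ₗ F × e ∈ S)
  degree≤6 {e} ¬all u ms =
    let T , T∈F , e∉T = find (¬All⇒Any¬ (e ∈?_) F ¬all)
        a , b , c , abc∈T , T⊆abc = enumerate T∈F
        pair≤2-through-e : ∀ {t} → t ∈ T → AtMost 2 (λ S → (S ∈ₗ F × e ∈ S) × t ∈ S)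
        pair≤2-through-e t∈T =
          AtMost-⊆ (λ ((S∈F , e∈S) , t∈S) → S∈F , e∈S , t∈S) (pair≤2 λ where refl → e∉T t∈T)
        meets-T : ∀ {S} → S ∈ₗ F × e ∈ S → Any (_∈ S) (a ∷ b ∷ c ∷ [])
        meets-T (S∈F , _) = let w , w∈S , w∈T = meet S∈F T∈F in lose (T⊆abc w∈T) w∈S
    in length≤cover (λ t → t ∈?_) (a ∷ b ∷ c ∷ []) (All.map pair≤2-through-e abc∈T) u ms
                    (All.map meets-T ms)

  common-vertex : 3 * 6 < length F → ∃[ v ] All (v ∈_) F
  common-vertex len with enumerate (∈-lookup {xs = F} (fromℕ< (≤-trans (s≤s z≤n) len)))
  ... | a , b , c , _ , S₀⊆abc with any? (λ e → all? (e ∈?_) F) (a ∷ b ∷ c ∷ [])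
  ...   | yes common = let v , _ , v∈F = find common in v , v∈F
  ...   | no ¬common =
    ⊥-elim (<⇒≱ len (length≤cover (λ e → e ∈?_) (a ∷ b ∷ c ∷ []) degrees noRepeats
                                  (All.tabulate id) (All.tabulate meets-S₀)))
    where
    degrees : All (λ e → AtMost 6 (λ S → S ∈ₗ F × e ∈ S)) (a ∷ b ∷ c ∷ [])
    degrees = All.map degree≤6 (¬Any⇒All¬ _ ¬common)
    meets-S₀ : ∀ {S} → S ∈ₗ F → Any (_∈ S) (a ∷ b ∷ c ∷ [])
    meets-S₀ S∈F = let w , w∈S , w∈S₀ = meet S∈F (∈-lookup _) in lose (S₀⊆abc w∈S₀) w∈S

  module CommonVertex {v : Fin n} (v∈F : All (v ∈_) F) (covered : ∀ x → ∃[ S ] (S ∈ₗ F × x ∈ S))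
                      (large : 4 * 2 < length F) where

    v∈ : ∀ {S} → S ∈ₗ F → v ∈ S
    v∈ = All.lookup v∈F

    isolated : ∀ {y} → ¬ v ~ y
    isolated {y} v~y = let S , S∈F , y∈S = covered y in independent S∈F (v∈ S∈F) y∈S v~y

    ~⇒≢v : ∀ {x y} → x ~ y → x ≢ v
    ~⇒≢v x~y refl = isolated x~y

    degree≤2 : ∀ {y} → y ≢ v → AtMost 2 (λ S → S ∈ₗ F × y ∈ S)
    degree≤2 y≢v = AtMost-⊆ (λ (S∈F , y∈S) → S∈F , v∈ S∈F , y∈S) (pair≤2 (≢-sym y≢v))

    ∃-avoiding : ∀ ys → All (_≢ v) ys → length ys ≤ 4 → ∃[ U ] (U ∈ₗ F × ¬ Any (_∈ U) ys)
    ∃-avoiding ys ys≢v len =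
      ∃-uncovered (λ y → y ∈?_) ys (All.map degree≤2 ys≢v) noRepeats (All.tabulate id)
                  (≤-trans (s≤s (*-monoˡ-≤ 2 len)) large)

    -- Every vertex outside S ∪ T is adjacent to x, so two members avoiding x, b and c close a
    -- triangle through x.
    two-sets-through : ∀ {x S T} → x ≢ v → S ∈ₗ F → T ∈ₗ F → S ≢ T → x ∈ S → x ∈ T → ⊥
    two-sets-through {x} {S} {T} x≢v S∈F T∈F S≢T x∈S x∈T =
      let _ , U₁∈F , U₁-avoids = ∃-avoiding (x ∷ b ∷ c ∷ []) (x≢v ∷ b≢v ∷ c≢v ∷ []) (n≤1+n 3)
          u , u∈U₁ , u∉[v] = ∃-fresh (v ∷ []) U₁∈F (s≤s (s≤s z≤n))
          u≢v = u∉[v] ∘ here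
          _ , U₂∈F , U₂-avoids = ∃-avoiding (x ∷ b ∷ c ∷ u ∷ []) (x≢v ∷ b≢v ∷ c≢v ∷ u≢v ∷ []) ≤-refl
          w , w∈U₂ , w~u = dominating U₂∈F (U₂-avoids ∘ there ∘ there ∘ there ∘ here)
          w≢v = ~⇒≢v w~u
          U₂-avoids-xbc = U₂-avoids ∘ Anyₚ.++⁺ˡ
      in no-triangle (x-adjacent (∉S U₁-avoids u∈U₁ u≢v) (∉T U₁-avoids u∈U₁ u≢v))
                     (~-sym w~u)
                     (x-adjacent (∉S U₂-avoids-xbc w∈U₂ w≢v) (∉T U₂-avoids-xbc w∈U₂ w≢v))
      where
      tS : Third S v x
      tS = third∈F S∈F (v∈ S∈F) x∈S (≢-sym x≢v)
      tT : Third T v x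
      tT = third∈F T∈F (v∈ T∈F) x∈T (≢-sym x≢v)
      b c : Fin n
      b = Third.z tS
      c = Third.z tT
      b≢v : b ≢ v
      b≢v = Third.z≢x tS
      c≢v : c ≢ v
      c≢v = Third.z≢x tT
      b~c : b ~ c
      b~c = thirds-adjacent S∈F T∈F S≢T (v∈ S∈F) x∈S (v∈ T∈F) x∈T tS tT

      x-adjacent : ∀ {y} → y ∉ S → y ∉ T → x ~ y
      x-adjacent y∉S y∉T
        with u , u∈S , u~y ← dominating S∈F y∉S | u′ , u′∈T , u′~y ← dominating T∈F y∉T
        with Third.p⊆xyz tS u∈S | Third.p⊆xyz tT u′∈T
      ... | here refl | _ = ⊥-elim (isolated u~y)
      ... | there (here refl) | _ = u~y
      ... | _ | here refl = ⊥-elim (isolated u′~y)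
      ... | _ | there (here refl) = u′~y
      ... | there (there (here refl)) | there (there (here refl)) = ⊥-elim (no-triangle b~c u′~y u~y)

      Avoids : Subset n → Set
      Avoids U = ¬ Any (_∈ U) (x ∷ b ∷ c ∷ [])
      ∉S : ∀ {U y} → Avoids U → y ∈ U → y ≢ v → y ∉ S
      ∉S avoid y∈U y≢v y∈S with Third.p⊆xyz tS y∈S
      ... | here refl = y≢v refl
      ... | there (here refl) = avoid (here y∈U)
      ... | there (there (here refl)) = avoid (there (here y∈U))
      ∉T : ∀ {U y} → Avoids U → y ∈ U → y ≢ v → y ∉ T
      ∉T avoid y∈U y≢v y∈T with Third.p⊆xyz tT y∈T
      ... | here refl = y≢v refl
      ... | there (here refl) = avoid (here y∈U)
      ... | there (there (here refl)) = avoid (there (there (here y∈U)))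

    unique-set : ∀ {x S T} → x ≢ v → S ∈ₗ F → T ∈ₗ F → x ∈ S → x ∈ T → S ≡ T
    unique-set {S = S} {T} x≢v S∈F T∈F x∈S x∈T with ≡-dec Bool._≟_ S T
    ... | yes S≡T = S≡T
    ... | no S≢T = ⊥-elim (two-sets-through x≢v S∈F T∈F S≢T x∈S x∈T)

    ∉-other-set : ∀ {S U x u} → U ∈ₗ F → S ∈ₗ F → x ∉ U → x ∈ S → u ≢ v → u ∈ U → u ∉ S
    ∉-other-set U∈F S∈F x∉U x∈S u≢v u∈U u∈S = x∉U (subst (_ ∈_) (unique-set u≢v S∈F U∈F u∈S u∈U) x∈S)

    record Matched (S : Subset n) (x y : Fin n) : Set where
      field
        S∈F   : S ∈ₗ F
        x∈S   : x ∈ S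
        y∈S   : y ∈ S
        x≢v   : x ≢ v
        y≢v   : y ≢ v
        x≢y   : x ≢ y
        S⊆vxy : S ⊆ₗ v ∷ x ∷ y ∷ []

    partner : ∀ {S x} → S ∈ₗ F → x ∈ S → x ≢ v → ∃[ y ] Matched S x y
    partner S∈F x∈S x≢v = let t = third∈F S∈F (v∈ S∈F) x∈S (≢-sym x≢v) in
      Third.z t , record
        { S∈F = S∈F ; x∈S = x∈S ; y∈S = Third.z∈p t ; x≢v = x≢v ; y≢v = Third.z≢x t
        ; x≢y = ≢-sym (Third.z≢y t) ; S⊆vxy = Third.p⊆xyz t }

    Matched-sym : ∀ {S x y} → Matched S x y → Matched S y x
    Matched-sym {x = x} {y} m = record
      { S∈F = S∈F ; x∈S = y∈S ; y∈S = x∈S ; x≢v = y≢v ; y≢v = x≢v ; x≢y = ≢-sym x≢y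
      ; S⊆vxy = λ w∈S → swap (S⊆vxy w∈S) }
      where
      open Matched m
      swap : ∀ {w} → w ∈ₗ v ∷ x ∷ y ∷ [] → w ∈ₗ v ∷ y ∷ x ∷ []
      swap (here w≡v) = here w≡v
      swap (there (here w≡x)) = there (there (here w≡x))
      swap (there (there (here w≡y))) = there (here w≡y)

    no-common-neighbour : ∀ {S x y a} → Matched S x y → a ~ x → a ~ y → ⊥
    no-common-neighbour {S} {x} {y} {a} m a~x a~y
      with U , U∈F , U-avoids ← ∃-avoiding (a ∷ x ∷ []) (~⇒≢v a~x ∷ Matched.x≢v m ∷ []) (s≤s (s≤s z≤n))
      with u , u∈U , u~a ← dominating U∈F (U-avoids ∘ here)
      with w , w∈S , w~u ← dominating (Matched.S∈F m)
                             (∉-other-set U∈F (Matched.S∈F m) (U-avoids ∘ there ∘ here) (Matched.x∈S m) (~⇒≢v u~a) u∈U)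
      with Matched.S⊆vxy m w∈S
    ... | here refl = isolated w~u
    ... | there (here refl) = no-triangle a~x w~u (~-sym u~a)
    ... | there (there (here refl)) = no-triangle a~y w~u (~-sym u~a)

    outside-adjacent : ∀ {S x y z} → Matched S x y → z ∉ S → x ~ z ⊎ y ~ z
    outside-adjacent m z∉S
      with u , u∈S , u~z ← dominating (Matched.S∈F m) z∉S
      with Matched.S⊆vxy m u∈S
    ... | here refl = ⊥-elim (isolated u~z)
    ... | there (here refl) = inj₁ u~z
    ... | there (there (here refl)) = inj₂ u~z

    -- For matched p and q: the side of q in the bipartition of H − v.
    Opposite : Fin n → Fin n → Fin n → Set
    Opposite p q x = x ≡ q ⊎ p ~ x

    module Reference {S₀ p q} (ref : Matched S₀ p q) where
      open Matched ref using ()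
        renaming (S∈F to S₀∈F; x∈S to p∈S₀; y∈S to q∈S₀; y≢v to q≢v; S⊆vxy to S₀⊆vpq)

      through-q⇒≡S₀ : ∀ {S} → S ∈ₗ F → q ∈ S → S ≡ S₀
      through-q⇒≡S₀ S∈F q∈S = unique-set q≢v S∈F S₀∈F q∈S q∈S₀

      Opposite-total : ∀ {x} → x ≢ v → Opposite p q x ⊎ Opposite q p x
      Opposite-total {x} x≢v with x ∈? S₀
      ... | yes x∈S₀ with S₀⊆vpq x∈S₀
      ...   | here refl = ⊥-elim (x≢v refl)
      ...   | there (here refl) = inj₂ (inj₁ refl)
      ...   | there (there (here refl)) = inj₁ (inj₁ refl)
      Opposite-total x≢v | no x∉S₀ with outside-adjacent ref x∉S₀
      ... | inj₁ p~x = inj₁ (inj₂ p~x)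
      ... | inj₂ q~x = inj₂ (inj₂ q~x)

      Opposite-independent : ∀ {x y} → Opposite p q x → Opposite p q y → ¬ x ~ y
      Opposite-independent (inj₁ refl) (inj₁ refl) = ~-irrefl
      Opposite-independent (inj₁ refl) (inj₂ p~y) q~y = no-common-neighbour ref (~-sym p~y) (~-sym q~y)
      Opposite-independent (inj₂ p~x) (inj₁ refl) x~q = no-common-neighbour ref (~-sym p~x) x~q
      Opposite-independent (inj₂ p~x) (inj₂ p~y) x~y = no-triangle p~x x~y p~y

      Matched⇒¬Opposite² : ∀ {S x y} → Matched S x y → Opposite p q x → Opposite p q y → ⊥
      Matched⇒¬Opposite² m (inj₁ refl) (inj₁ refl) = Matched.x≢y m refl
      Matched⇒¬Opposite² {S} {y = y} m (inj₁ refl) (inj₂ p~y)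
        with S₀⊆vpq (subst (y ∈_) (through-q⇒≡S₀ (Matched.S∈F m) (Matched.x∈S m)) (Matched.y∈S m))
      ... | here refl = Matched.y≢v m refl
      ... | there (here refl) = ~-irrefl p~y
      ... | there (there (here refl)) = Matched.x≢y m refl
      Matched⇒¬Opposite² m (inj₂ p~x) (inj₁ refl) =
        Matched⇒¬Opposite² (Matched-sym m) (inj₁ refl) (inj₂ p~x)
      Matched⇒¬Opposite² m (inj₂ p~x) (inj₂ p~y) = no-common-neighbour m p~x p~y

      partner∉S₀ : ∀ {S x x′} → Matched S x x′ → p ~ x → x′ ∉ S₀
      partner∉S₀ {x = x} m p~x x′∈S₀ =
        let S≡S₀ = unique-set (Matched.y≢v m) (Matched.S∈F m) S₀∈F (Matched.y∈S m) x′∈S₀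
        in independent S₀∈F p∈S₀ (subst (x ∈_) S≡S₀ (Matched.x∈S m)) p~x

      Opposite-cross : ∀ {S x x′ y} → Opposite p q x → Opposite q p y → Matched S x x′ → y ∉ S → x ~ y
      Opposite-cross (inj₁ refl) (inj₁ refl) m p∉S =
        ⊥-elim (p∉S (subst (p ∈_) (sym (through-q⇒≡S₀ (Matched.S∈F m) (Matched.x∈S m))) p∈S₀))
      Opposite-cross (inj₁ refl) (inj₂ q~y) m y∉S = q~y
      Opposite-cross (inj₂ p~x) (inj₁ refl) m y∉S = ~-sym p~x
      Opposite-cross (inj₂ p~x) (inj₂ q~y) m y∉S with outside-adjacent m y∉S
      ... | inj₁ x~y = x~y
      ... | inj₂ x′~y with outside-adjacent ref (partner∉S₀ m p~x)
      ...   | inj₁ p~x′ = ⊥-elim (no-common-neighbour m p~x p~x′)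
      ...   | inj₂ q~x′ = ⊥-elim (no-triangle q~x′ x′~y q~y)

    ∃-Matched : ∃[ S ] ∃[ x ] ∃[ y ] Matched S x y
    ∃-Matched =
      let S∈F = ∈-lookup (fromℕ< (≤-trans (s≤s z≤n) large))
          x , x∈S , x∉[v] = ∃-fresh (v ∷ []) S∈F (s≤s (s≤s z≤n))
          y , m = partner S∈F x∈S (x∉[v] ∘ here)
      in _ , x , y , m

    module Bipartition {S₀ r r̄} (ref : Matched S₀ r r̄) where
      open Reference

      Opposite? : ∀ p q → Decidable (Opposite p q)
      Opposite? p q x = (x ≟ q) ⊎-dec (adj H p x Bool.≟ true)

      side : Fin n → Bool
      side x = does (Opposite? r r̄ x)

      Side : Bool → Fin n → Set
      Side true = Opposite r r̄
      Side false = Opposite r̄ r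

      side-correct : ∀ {x} → x ≢ v → Side (side x) x
      side-correct {x} x≢v = decided (Opposite? r r̄ x)
        where
        decided : (d : Dec (Opposite r r̄ x)) → Side (does d) x
        decided (yes o) = o
        decided (no ¬o) = [ (λ o → ⊥-elim (¬o o)) , id ]′ (Opposite-total ref x≢v)

      Side-independent : ∀ b {x y} → Side b x → Side b y → ¬ x ~ y
      Side-independent true = Opposite-independent ref
      Side-independent false = Opposite-independent (Matched-sym ref)

      Side-matched : ∀ b {S x y} → Matched S x y → Side b x → Side b y → ⊥
      Side-matched true = Matched⇒¬Opposite² ref
      Side-matched false = Matched⇒¬Opposite² (Matched-sym ref)

      Side-cross : ∀ b {S x x′ y} → Side b x → Side (not b) y → Matched S x x′ → y ∉ S → x ~ y
      Side-cross true = Opposite-cross ref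
      Side-cross false = Opposite-cross (Matched-sym ref)

      matched⇒sides-differ : ∀ {S x y} → Matched S x y → side x ≢ side y
      matched⇒sides-differ {x = x} {y} m eq = Side-matched (side x) m (side-correct (Matched.x≢v m))
        (subst (λ b → Side b y) (sym eq) (side-correct (Matched.y≢v m)))

      adjacent⇒sides-differ : ∀ {x y} → x ~ y → side x ≢ side y
      adjacent⇒sides-differ {x} {y} x~y eq = Side-independent (side x) (side-correct (~⇒≢v x~y))
        (subst (λ b → Side b y) (sym eq) (side-correct (~⇒≢v (~-sym x~y)))) x~y

      sides-differ⇒adjacent : ∀ {S x x′ y} → side x ≢ side y → Matched S x x′ → y ∉ S → y ≢ v → x ~ y
      sides-differ⇒adjacent {x = x} {y = y} ne m y∉S y≢v =
        Side-cross (side x) (side-correct (Matched.x≢v m)) (subst (λ b → Side b y) (¬-not (ne ∘ sym)) (side-correct y≢v)) m y∉S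

      block : Fin n → Fin (length F)
      block x = Any.index (proj₁ (proj₂ (covered x)))

      ∈-block : ∀ x → x ∈ lookup F (block x)
      ∈-block x = let _ , S∈F , x∈S = covered x in subst (x ∈_) (Anyₚ.lookup-index S∈F) x∈S

      block-unique : ∀ {x i} → x ≢ v → x ∈ lookup F i → block x ≡ i
      block-unique {x} x≢v x∈Fᵢ =
        Unique⇒lookup-injective noRepeats (unique-set x≢v (∈-lookup _) (∈-lookup _) (∈-block x) x∈Fᵢ)

      embed : Fin n → V′ (length F)
      embed x with x ≟ v
      ... | yes _ = nothing
      ... | no _ = just (block x , side x)

      embed-v : embed v ≡ nothing
      embed-v with v ≟ v
      ... | yes _ = refl
      ... | no v≢v = ⊥-elim (v≢v refl)

      embed-≢v : ∀ {x} → x ≢ v → embed x ≡ just (block x , side x)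
      embed-≢v {x} x≢v with x ≟ v
      ... | yes x≡v = ⊥-elim (x≢v x≡v)
      ... | no _ = refl

      same-block-and-side : ∀ {x y} → x ≢ v → y ≢ v → block x ≡ block y → side x ≡ side y → x ≡ y
      same-block-and-side {x} {y} x≢v y≢v bx≡by sx≡sy
        with x′ , m ← partner (∈-lookup (block x)) (∈-block x) x≢v
        with Matched.S⊆vxy m (subst (λ i → y ∈ lookup F i) (sym bx≡by) (∈-block y))
      ... | here refl = ⊥-elim (y≢v refl)
      ... | there (here refl) = refl
      ... | there (there (here refl)) = ⊥-elim (matched⇒sides-differ m sx≡sy)

      embed-injective : Injective _≡_ _≡_ embed
      embed-injective {x} {y} eq with x ≟ v | y ≟ v
      embed-injective _ | yes refl | yes refl = refl
      embed-injective () | yes _ | no _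
      embed-injective () | no _ | yes _
      embed-injective eq | no x≢v | no y≢v =
        same-block-and-side x≢v y≢v (,-injectiveˡ (just-injective eq)) (,-injectiveʳ (just-injective eq))

      embed-∈ : ∀ {x i} → x ≢ v → x ∈ lookup F i → embed x ≡ just (i , side x)
      embed-∈ {x} x≢v x∈Fᵢ =
        trans (embed-≢v x≢v) (cong (λ j → just (j , side x)) (block-unique x≢v x∈Fᵢ))

      embed-surjective : Surjective _≡_ _≡_ embed
      embed-surjective nothing = v , λ where refl → embed-v
      embed-surjective (just (i , b))
        with y , y∈Fᵢ , y∉[v] ← ∃-fresh (v ∷ []) (∈-lookup i) (s≤s (s≤s z≤n))
        with y′ , m ← partner (∈-lookup i) y∈Fᵢ (y∉[v] ∘ here)
        with side y Bool.≟ b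
      ... | yes refl = y , λ where refl → embed-∈ (Matched.x≢v m) y∈Fᵢ
      ... | no sy≢b = y′ , λ where refl → embed-y′
        where
        sy′≡b : side y′ ≡ b
        sy′≡b = begin
          side y′           ≡⟨ ¬-not (matched⇒sides-differ (Matched-sym m)) ⟩
          not (side y)      ≡⟨ cong not (¬-not sy≢b) ⟩
          not (not b)       ≡⟨ not-involutive b ⟩
          b                 ∎
          where open ≡-Reasoning
        embed-y′ : embed y′ ≡ just (i , b)
        embed-y′ = trans (embed-∈ (Matched.y≢v m) (Matched.y∈S m)) (cong (λ c → just (i , c)) sy′≡b)

      embed-adjacent : ∀ x y → x ~ y ⇔ AdjH′ (embed x) (embed y)
      embed-adjacent x y with x ≟ v | y ≟ v
      ... | yes refl | _ = mk⇔ isolated λ ()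
      ... | no _ | yes refl = mk⇔ (isolated ∘ ~-sym) λ ()
      ... | no x≢v | no y≢v = mk⇔ (λ x~y → adjacent⇒sides-differ x~y , blocks-differ x~y) from
        where
        blocks-differ : x ~ y → block x ≢ block y
        blocks-differ x~y bx≡by =
          independent (∈-lookup _) (∈-block x) (subst (λ i → y ∈ lookup F i) (sym bx≡by) (∈-block y)) x~y
        from : side x ≢ side y × block x ≢ block y → x ~ y
        from (sx≢sy , bx≢by) =
          let _ , m = partner (∈-lookup (block x)) (∈-block x) x≢v
          in sides-differ⇒adjacent sx≢sy m (λ y∈ → bx≢by (sym (block-unique y≢v y∈))) y≢v

      embed-block : ∀ i x → x ∈ lookup F i ⇔ InF′ i (embed x)
      embed-block i x with x ≟ v
      ... | yes refl = mk⇔ _ λ _ → v∈ (∈-lookup i)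
      ... | no x≢v = mk⇔ (block-unique x≢v) λ where refl → ∈-block x

      isomorphism : IsoToH′ H F (length F)
      isomorphism =
        mk⤖ (embed-injective , embed-surjective) , embed-adjacent , block-of-set , set-of-block
        where
        block-of-set : ∀ S → S ∈ₗ F → ∃[ i ] (∀ x → x ∈ S ⇔ InF′ i (embed x))
        block-of-set S S∈F = let i = Any.index S∈F in
          i , λ x → subst (λ T → x ∈ T ⇔ InF′ i (embed x)) (sym (Anyₚ.lookup-index S∈F))
                          (embed-block i x)
        set-of-block : ∀ i → ∃[ S ] (S ∈ₗ F × (∀ x → x ∈ S ⇔ InF′ i (embed x)))
        set-of-block i = lookup F i , ∈-lookup i , embed-block i

isomorphic : ∀ {n} {H : Graph n} {F} → IsSystem33 H F → 3 * 6 < length F →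
             (∀ x → ∃[ S ] (S ∈ₗ F × x ∈ S)) → IsoToH′ H F (length F)
isomorphic sys large covered = let _ , _ , _ , ref = ∃-Matched in Bipartition.isomorphism ref
  where
  open System33 sys
  open CommonVertex (proj₂ (common-vertex large)) covered (≤-trans (m≤m+n 9 10) large)

lemma34 : ∃[ C ] (∀ (n : ℕ) (H : Graph n) (F : List (Subset n))
            → IsSystem33 H F
            → length F ≥ C
            → (∀ x → ∃[ S ] (S LM.∈ F × x ∈ S))
            → ∃[ m ] IsoToH′ H F m)
lemma34 = 19 , λ n H F sys large covered → length F , isomorphic sys large covered
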